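{- Let $G$ be a biconnected cubic graph and let $G_1'$ be obtained from $G$ by the construction described in the context. Then every edge of $G_1'$ lies in a cycle of $G_1'$ (equivalently, $G_1'$ has no bridge).
   Context: All graphs are finite, simple (no loops, no multiple edges) and connected. A graph is cubic if every vertex has degree $3$. A bridge is an edge whose removal disconnects the graph; a bridge graph is a graph with at least one bridge. A graph is biconnected if it has no bridge but has some edge whose removal produces a graph with a bridge. In a biconnected graph, a bi-bridge is a set of two edges whose removal disconnects the graph. Two edges are called distinct if there is no graph automorphism mapping one edge to the other. An induced subgraph on a vertex set $S$ consists of $S$ and all edges with both endpoints in $S$. Construction. Let $G$ be a biconnected cubic graph. Among all bi-bridges of $G$, choose one whose removal splits the vertex set into two parts that are as equal in size as possible (ties broken arbitrarily). Removing it leaves two induced subgraphs; let $G_1$ be the one with more pairwise distinct edges lying in cycles, and $G_2$ the other. Write the bi-bridge as $\{x_1y_1, x_2y_2\}$ with $x_1,x_2\in G_2$ and $y_1,y_2\in G_1$, the four endpoints being distinct. Form $G'$ by deleting the edges $x_1y_1, x_2y_2$, adding four new vertices $p,q,r,s$, and adding the edges $px_1, px_2, pq, qr, qs, ry_1, sy_2$. Then $pq$ is a bridge of $G'$. Let $G_1'$ be the component of $G'$ with the edge $pq$ removed that contains $q$ (it consists of $G_1$ together with $q,r,s$ and the edges $qr,qs,ry_1,sy_2$). -}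

module Defs where

open import Data.Nat using (ℕ; zero; suc; _+_; _∸_; _≤_; ∣_-_∣)
open import Data.Fin using (Fin; zero; suc; _≟_)
open import Data.Bool using (Bool; true; false; _∧_; _∨_; not)
open import Data.Vec using (tabulate)
open import Data.Fin.Subset using (∣_∣)
open import Data.List using (List; []; _∷_; _++_; length)
open import Data.List.Relation.Unary.Unique.Propositional using (Unique)
open import Data.List.Relation.Unary.All using (All)
open import Data.List.Relation.Unary.Any using (Any)
open import Data.Product using (Σ; ∃; _×_; _,_)
open import Data.Sum using (_⊎_)
open import Data.Unit using (⊤)
open import Relation.Nullary using (¬_)
open import Relation.Nullary.Decidable using (⌊_⌋)
open import Relation.Binary.PropositionalEquality using (_≡_; _≢_)
open import Function.Definitions using (Injective; Bijective)

Adj : ℕ → Set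
Adj n = Fin n → Fin n → Bool

-- simple graph: symmetric, no loops (no multiple edges is automatic)
SimpleGraph : ∀ {n} → Adj n → Set
SimpleGraph {n} A = (∀ (i j : Fin n) → A i j ≡ A j i) × (∀ (i : Fin n) → A i i ≡ false)

Edge : ∀ {n} → Adj n → Fin n → Fin n → Set
Edge A u v = A u v ≡ true

-- degree of v is 3 (number of neighbours of v, counted as a subset of Fin n)
Cubic : ∀ {n} → Adj n → Set
Cubic {n} A = ∀ (v : Fin n) → ∣ tabulate (A v) ∣ ≡ 3

data Reach {n} (A : Adj n) : Fin n → Fin n → Set where
  here : ∀ {u} → Reach A u u
  step : ∀ {u v w} → Edge A u v → Reach A v w → Reach A u w

Connected : ∀ {n} → Adj n → Set
Connected {n} A = ∀ (u v : Fin n) → Reach A u v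

sameEdge : ∀ {n} → Fin n → Fin n → Fin n → Fin n → Bool
sameEdge u v i j = (⌊ i ≟ u ⌋ ∧ ⌊ j ≟ v ⌋) ∨ (⌊ i ≟ v ⌋ ∧ ⌊ j ≟ u ⌋)

removeEdge : ∀ {n} → Adj n → Fin n → Fin n → Adj n
removeEdge A u v i j = A i j ∧ not (sameEdge u v i j)

IsBridge : ∀ {n} → Adj n → Fin n → Fin n → Set
IsBridge A u v = Edge A u v × ¬ Connected (removeEdge A u v)

HasBridge : ∀ {n} → Adj n → Set
HasBridge {n} A = Σ (Fin n) λ u → Σ (Fin n) λ v → IsBridge A u v

Biconnected : ∀ {n} → Adj n → Set
Biconnected {n} A =
  Connected A × ¬ HasBridge A ×
  (Σ (Fin n) λ u → Σ (Fin n) λ v → Edge A u v × HasBridge (removeEdge A u v))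

removeTwo : ∀ {n} → Adj n → Fin n → Fin n → Fin n → Fin n → Adj n
removeTwo A a b c d = removeEdge (removeEdge A a b) c d

IsBiBridge : ∀ {n} → Adj n → Fin n → Fin n → Fin n → Fin n → Set
IsBiBridge A a b c d =
  Edge A a b × Edge A c d × sameEdge a b c d ≡ false × ¬ Connected (removeTwo A a b c d)

IsComponent : ∀ {n k} → Adj n → Fin n → (Fin k → Fin n) → Set
IsComponent {n} {k} A v ι =
  Injective _≡_ _≡_ ι × (∀ (w : Fin n) → ((Σ (Fin k) λ i → ι i ≡ w) → Reach A v w)
                                      × (Reach A v w → Σ (Fin k) λ i → ι i ≡ w))

induced : ∀ {n k} → Adj n → (Fin k → Fin n) → Adj k
induced A ι i j = A (ι i) (ι j)

Chain : ∀ {n} → Adj n → List (Fin n) → Set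
Chain A []            = ⊤
Chain A (x ∷ [])      = ⊤
Chain A (x ∷ y ∷ xs)  = Edge A x y × Chain A (y ∷ xs)

EdgeInCycle : ∀ {n} → Adj n → Fin n → Fin n → Set
EdgeInCycle {n} A u v =
  Edge A u v × Σ (List (Fin n)) λ ws →
    ws ≢ [] × Unique (v ∷ ws ++ u ∷ []) × Chain A (v ∷ ws ++ u ∷ [])

IsAutomorphism : ∀ {n} → Adj n → (Fin n → Fin n) → Set
IsAutomorphism {n} A σ = Bijective _≡_ _≡_ σ × (∀ (i j : Fin n) → A (σ i) (σ j) ≡ A i j)

AutEquivalent : ∀ {n} → Adj n → (Fin n × Fin n) → (Fin n × Fin n) → Set
AutEquivalent {n} A (a , b) (c , d) =
  Σ (Fin n → Fin n) λ σ → IsAutomorphism A σ × ((σ a ≡ c × σ b ≡ d) ⊎ (σ a ≡ d × σ b ≡ c))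

-- m is the number of pairwise distinct edges lying in cycles of A:
-- there is a list of m edges lying in cycles, pairwise distinct (no automorphism
-- maps one to another), and every edge lying in a cycle is not distinct from one of them
-- (i.e. m is the number of automorphism classes of edges lying in cycles).
PairwiseDistinct : ∀ {n} → Adj n → List (Fin n × Fin n) → Set
PairwiseDistinct A []       = ⊤
PairwiseDistinct A (e ∷ es) = All (λ f → ¬ AutEquivalent A e f) es × PairwiseDistinct A es

NumDistinctCycleEdges : ∀ {n} → Adj n → ℕ → Set
NumDistinctCycleEdges {n} A m =
  Σ (List (Fin n × Fin n)) λ L →
    length L ≡ m ×
    All (λ e → EdgeInCycle A (Data.Product.proj₁ e) (Data.Product.proj₂ e)) L ×
    PairwiseDistinct A L ×
    (∀ (u v : Fin n) → EdgeInCycle A u v → Any (λ e → AutEquivalent A (u , v) e) L)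

-- G₁' : G₁ together with new vertices q = 0, r = 1, s = 2 and edges qr, qs, ry₁, sy₂.
-- The old vertex i of G₁ becomes  suc (suc (suc i)).

extend : ∀ {k} → Adj k → Fin k → Fin k → Adj (suc (suc (suc k)))
extend A y₁ y₂ zero zero                                   = false
extend A y₁ y₂ zero (suc zero)                             = true
extend A y₁ y₂ zero (suc (suc zero))                       = true
extend A y₁ y₂ zero (suc (suc (suc j)))                    = false
extend A y₁ y₂ (suc zero) zero                             = true
extend A y₁ y₂ (suc zero) (suc zero)                       = false
extend A y₁ y₂ (suc zero) (suc (suc zero))                 = false
extend A y₁ y₂ (suc zero) (suc (suc (suc j)))              = ⌊ j ≟ y₁ ⌋
extend A y₁ y₂ (suc (suc zero)) zero                       = true
extend A y₁ y₂ (suc (suc zero)) (suc zero)                 = false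
extend A y₁ y₂ (suc (suc zero)) (suc (suc zero))           = false
extend A y₁ y₂ (suc (suc zero)) (suc (suc (suc j)))        = ⌊ j ≟ y₂ ⌋
extend A y₁ y₂ (suc (suc (suc i))) zero                    = false
extend A y₁ y₂ (suc (suc (suc i))) (suc zero)              = ⌊ i ≟ y₁ ⌋
extend A y₁ y₂ (suc (suc (suc i))) (suc (suc zero))        = ⌊ i ≟ y₂ ⌋
extend A y₁ y₂ (suc (suc (suc i))) (suc (suc (suc j)))     = A i j

module Submission where

-- G₁′ is connected, and each of its edges has a detour avoiding it. The four new edges lie on
-- the cycle q r y₁ ⋯ y₂ s q, closed by a walk inside the connected graph G₁. For an edge e of
-- G₁, G − e is connected since G is bridgeless; contracting everything outside G₁ to q maps a
-- walk around e in G to one in G₁′, because the only edges leaving G₁ are the bi-bridge edges,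
-- which end in y₁ and y₂, and these are joined to q through r and s.

open import Defs
open import Data.Nat using (ℕ; _+_; _∸_; _≤_; ∣_-_∣)
open import Data.Fin using (Fin; zero; suc; _≟_)
open import Data.Fin.Properties using (any?; suc-injective)
open import Data.Bool using (true; false; _∧_; _∨_; not)
open import Data.Bool.Properties using (∧-zeroʳ; ∧-comm; ∨-comm)
open import Data.Product using (Σ; _×_; _,_; proj₁; proj₂)
open import Data.Sum using (_⊎_; inj₁; inj₂)
open import Data.Empty using (⊥-elim)
open import Function using (_∘_)
open import Function.Definitions using (Injective)
open import Relation.Nullary using (¬_; yes; no)
open import Relation.Nullary.Decidable using (⌊_⌋)
open import Relation.Nullary.Negation using (contradiction; ¬¬-map)
open import Relation.Binary.PropositionalEquality
  using (_≡_; _≢_; refl; sym; trans; cong; cong₂; subst; subst₂)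

Sym : ∀ {n} → Adj n → Set
Sym {n} H = ∀ (i j : Fin n) → H i j ≡ H j i

module _ {n} {H : Adj n} where

  Reach-trans : ∀ {a b c} → Reach H a b → Reach H b c → Reach H a c
  Reach-trans here       q = q
  Reach-trans (step e p) q = step e (Reach-trans p q)

  Reach-sym : Sym H → ∀ {a b} → Reach H a b → Reach H b a
  Reach-sym symH here               = here
  Reach-sym symH (step {u} {v} e p) = Reach-trans (Reach-sym symH p) (step (trans (symH v u) e) here)

Reach-map : ∀ {n m} {H : Adj n} {H′ : Adj m} (f : Fin n → Fin m) →
            (∀ {u v} → Edge H u v → Reach H′ (f u) (f v)) →
            ∀ {a b} → Reach H a b → Reach H′ (f a) (f b)
Reach-map f edge here       = here
Reach-map f edge (step e p) = Reach-trans (edge e) (Reach-map f edge p)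

Reach-mono : ∀ {n} {H H′ : Adj n} → (∀ {u v} → Edge H u v → Edge H′ u v) →
             ∀ {a b} → Reach H a b → Reach H′ a b
Reach-mono sub = Reach-map (λ v → v) (λ e → step (sub e) here)

≟-refl : ∀ {n} (a : Fin n) → ⌊ a ≟ a ⌋ ≡ true
≟-refl a with a ≟ a
... | yes _   = refl
... | no a≢a = ⊥-elim (a≢a refl)

≟-true⇒≡ : ∀ {n} {a b : Fin n} → ⌊ a ≟ b ⌋ ≡ true → a ≡ b
≟-true⇒≡ {a = a} {b} e with a ≟ b
... | yes a≡b = a≡b
≟-true⇒≡ () | no _

≟-injective : ∀ {m n} {f : Fin m → Fin n} → Injective _≡_ _≡_ f →
              ∀ a b → ⌊ f a ≟ f b ⌋ ≡ ⌊ a ≟ b ⌋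
≟-injective {f = f} f-inj a b with a ≟ b | f a ≟ f b
... | yes refl | yes _     = refl
... | yes refl | no fa≢fa  = ⊥-elim (fa≢fa refl)
... | no a≢b   | yes fa≡fb = ⊥-elim (a≢b (f-inj fa≡fb))
... | no _     | no _      = refl

sameEdge-injective : ∀ {m n} {f : Fin m → Fin n} → Injective _≡_ _≡_ f →
                     ∀ u v i j → sameEdge (f u) (f v) (f i) (f j) ≡ sameEdge u v i j
sameEdge-injective f-inj u v i j =
  cong₂ _∨_ (cong₂ _∧_ (≟-injective f-inj i u) (≟-injective f-inj j v))
            (cong₂ _∧_ (≟-injective f-inj i v) (≟-injective f-inj j u))

sameEdge-true : ∀ {n} (u v i j : Fin n) → sameEdge u v i j ≡ true →
                (i ≡ u × j ≡ v) ⊎ (i ≡ v × j ≡ u)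
sameEdge-true u v i j e with i ≟ u | j ≟ v | i ≟ v | j ≟ u
... | yes i≡u | yes j≡v | _       | _       = inj₁ (i≡u , j≡v)
... | _       | _       | yes i≡v | yes j≡u = inj₂ (i≡v , j≡u)
sameEdge-true _ _ _ _ () | yes _ | no _ | yes _ | no _
sameEdge-true _ _ _ _ () | yes _ | no _ | no _  | _
sameEdge-true _ _ _ _ () | no _  | _    | yes _ | no _
sameEdge-true _ _ _ _ () | no _  | _    | no _  | _

module _ {n} {H : Adj n} {u v : Fin n} where

  removeEdge⁺ : ∀ {i j} → Edge H i j → sameEdge u v i j ≡ false → Edge (removeEdge H u v) i j
  removeEdge⁺ e ne rewrite e | ne = refl

  removeEdge⁻ : ∀ {i j} → Edge (removeEdge H u v) i j → Edge H i j × sameEdge u v i j ≡ false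
  removeEdge⁻ {i} {j} e with H i j | sameEdge u v i j
  removeEdge⁻ e  | true  | false = refl , refl
  removeEdge⁻ () | true  | true
  removeEdge⁻ () | false | _

  removeEdge-sym : Sym H → Sym (removeEdge H u v)
  removeEdge-sym symH i j = cong₂ _∧_ (symH i j) (cong not
    (trans (∨-comm (⌊ i ≟ u ⌋ ∧ ⌊ j ≟ v ⌋) _)
           (cong₂ _∨_ (∧-comm ⌊ i ≟ v ⌋ ⌊ j ≟ u ⌋) (∧-comm ⌊ i ≟ u ⌋ ⌊ j ≟ v ⌋))))

  removeEdge-flip : ∀ i j → removeEdge H u v i j ≡ removeEdge H v u i j
  removeEdge-flip i j = cong (λ b → H i j ∧ not b) (∨-comm (⌊ i ≟ u ⌋ ∧ ⌊ j ≟ v ⌋) _)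

  removeEdge-detour : Sym H → Reach (removeEdge H u v) u v →
                      ∀ {a b} → Reach H a b → Reach (removeEdge H u v) a b
  removeEdge-detour symH detour here = here
  removeEdge-detour symH detour (step {w} {w′} e p) with sameEdge u v w w′ in removed
  ... | false = step (removeEdge⁺ e removed) (removeEdge-detour symH detour p)
  ... | true with sameEdge-true u v w w′ removed
  ...   | inj₁ (refl , refl) = Reach-trans detour (removeEdge-detour symH detour p)
  ...   | inj₂ (refl , refl) =
          Reach-trans (Reach-sym (removeEdge-sym symH) detour) (removeEdge-detour symH detour p)

  detour-reverse : Sym H → Reach (removeEdge H u v) u v → Reach (removeEdge H v u) v u
  detour-reverse symH detour =
    Reach-mono (λ {i} {j} e → trans (sym (removeEdge-flip i j)) e) (Reach-sym (removeEdge-sym symH) detour)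

  crossing-edge-removed : ∀ {c a b} → Reach (removeEdge H u v) c a → ¬ Reach (removeEdge H u v) c b →
                          Edge H a b → sameEdge u v a b ≡ true
  crossing-edge-removed {a = a} {b} c↝a c↝̸b e with sameEdge u v a b in removed
  ... | true  = refl
  ... | false = ⊥-elim (c↝̸b (Reach-trans c↝a (step (removeEdge⁺ e removed) here)))

removeEdge-induced : ∀ {m n} {H : Adj n} {f : Fin m → Fin n} → Injective _≡_ _≡_ f →
                     ∀ u v i j → removeEdge (induced H f) u v i j ≡ removeEdge H (f u) (f v) (f i) (f j)
removeEdge-induced {H = H} {f} f-inj u v i j =
  cong (λ b → H (f i) (f j) ∧ not b) (sym (sameEdge-injective f-inj u v i j))

crossing-edge-removed₂ : ∀ {n} {H : Adj n} {x₁ y₁ x₂ y₂ c a b} →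
  Reach (removeTwo H x₁ y₁ x₂ y₂) c a → ¬ Reach (removeTwo H x₁ y₁ x₂ y₂) c b → Edge H a b →
  sameEdge x₁ y₁ a b ≡ true ⊎ sameEdge x₂ y₂ a b ≡ true
crossing-edge-removed₂ {H = H} {x₁} {y₁} {a = a} {b} c↝a c↝̸b e with sameEdge x₁ y₁ a b in removed
... | true  = inj₁ refl
... | false = inj₂ (crossing-edge-removed c↝a c↝̸b (removeEdge⁺ {H = H} {x₁} {y₁} e removed))

-- Detours are only required up to double negation: ¬ HasBridge merely gives ¬ ¬ Connected.
bridgeless-by-detours : ∀ {n} {H : Adj n} → Sym H → Connected H →
                        (∀ u v → Edge H u v → ¬ ¬ Reach (removeEdge H u v) u v) → ¬ HasBridge H
bridgeless-by-detours symH conn detour (u , v , e , disconnected) =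
  detour u v e λ d → disconnected λ a b → removeEdge-detour symH d (conn a b)

module _ {n k} {H : Adj n} {c : Fin n} {ι : Fin k → Fin n} (comp : IsComponent H c ι) where

  component-reach : ∀ a → Reach H c (ι a)
  component-reach a = proj₁ (proj₂ comp (ι a)) (a , refl)

  component-member : ∀ {w} → Reach H c w → Σ (Fin k) λ a → ι a ≡ w
  component-member {w} = proj₂ (proj₂ comp w)

  component-walk : ∀ a {v w} → ι a ≡ v → Reach H v w → Σ (Fin k) λ b → ι b ≡ w × Reach (induced H ι) a b
  component-walk a refl here = a , refl , here
  component-walk a refl (step {v = v} e p)
    with a′ , ιa′≡v ← component-member (Reach-trans (component-reach a) (step e here))
    with b , ιb≡w , walk ← component-walk a′ ιa′≡v p
    = b , ιb≡w , step (subst (Edge H (ι a)) (sym ιa′≡v) e) walk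

  component-connected : Sym H → Connected (induced H ι)
  component-connected symH a b =
    Reach-trans (Reach-sym (λ i j → symH (ι i) (ι j)) (from-root a)) (from-root b)
    where
    root : Σ (Fin k) λ r → ι r ≡ c
    root = component-member here

    from-root : ∀ b → Reach (induced H ι) (proj₁ root) b
    from-root b with b′ , ιb′≡ιb , walk ← component-walk (proj₁ root) (proj₂ root) (component-reach b)
      = subst (Reach (induced H ι) (proj₁ root)) (proj₁ comp ιb′≡ιb) walk

pattern q     = zero
pattern r     = suc zero
pattern s     = suc (suc zero)
pattern old i = suc (suc (suc i))

old-injective : ∀ {k} → Injective _≡_ _≡_ (λ (i : Fin k) → old i)
old-injective = suc-injective ∘ suc-injective ∘ suc-injective

module Extension {k} (G : Adj k) (symG : Sym G) (connG : Connected G) (y₁ y₂ : Fin k) where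

  E : Adj (3 + k)
  E = extend G y₁ y₂

  extend-sym : Sym E
  extend-sym q       q       = refl
  extend-sym q       r       = refl
  extend-sym q       s       = refl
  extend-sym q       (old j) = refl
  extend-sym r       q       = refl
  extend-sym r       r       = refl
  extend-sym r       s       = refl
  extend-sym r       (old j) = refl
  extend-sym s       q       = refl
  extend-sym s       r       = refl
  extend-sym s       s       = refl
  extend-sym s       (old j) = refl
  extend-sym (old i) q       = refl
  extend-sym (old i) r       = refl
  extend-sym (old i) s       = refl
  extend-sym (old i) (old j) = symG i j

  lift : ∀ {u v} → (∀ a b → sameEdge u v (old a) (old b) ≡ false) →
         ∀ {a b} → Reach G a b → Reach (removeEdge E u v) (old a) (old b)
  lift {u} {v} avoid =
    Reach-map (λ i → old i) (λ {a} {b} e → step (removeEdge⁺ {H = E} {u} {v} {old a} {old b} e (avoid a b)) here)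

  via : ∀ {u v} i j {w} → Edge E i j → sameEdge u v i j ≡ false →
        Reach (removeEdge E u v) j w → Reach (removeEdge E u v) i w
  via {u} {v} i j e kept = step (removeEdge⁺ {H = E} {u} {v} {i} {j} e kept)

  extend-connected : Connected E
  extend-connected a b = Reach-trans (to-q a) (Reach-sym extend-sym (to-q b))
    where
    to-q : ∀ v → Reach E v q
    to-q q       = here
    to-q r       = step refl here
    to-q s       = step refl here
    to-q (old i) = Reach-trans (Reach-map (λ i → old i) (λ e → step e here) (connG i y₁))
                               (step {v = r} (≟-refl y₁) (step refl here))

  detour-qr : Reach (removeEdge E q r) q r
  detour-qr = via q s refl refl (via s (old y₂) (≟-refl y₂) refl
    (Reach-trans (lift (λ _ _ → refl) (connG y₂ y₁)) (via (old y₁) r (≟-refl y₁) refl here)))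

  detour-qs : Reach (removeEdge E q s) q s
  detour-qs = via q r refl refl (via r (old y₁) (≟-refl y₁) refl
    (Reach-trans (lift (λ _ _ → refl) (connG y₁ y₂)) (via (old y₂) s (≟-refl y₂) refl here)))

  detour-ry₁ : Reach (removeEdge E r (old y₁)) r (old y₁)
  detour-ry₁ = via r q refl refl (via q s refl refl (via s (old y₂) (≟-refl y₂) refl
    (lift (λ a _ → ∧-zeroʳ ⌊ old a ≟ old y₁ ⌋) (connG y₂ y₁))))

  detour-sy₂ : Reach (removeEdge E s (old y₂)) s (old y₂)
  detour-sy₂ = via s q refl refl (via q r refl refl (via r (old y₁) (≟-refl y₁) refl
    (lift (λ a _ → ∧-zeroʳ ⌊ old a ≟ old y₂ ⌋) (connG y₁ y₂))))

  exit₁ : ∀ i j → Reach (removeEdge E (old i) (old j)) (old y₁) q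
  exit₁ i j = via (old y₁) r (≟-refl y₁)
    (cong₂ _∨_ (∧-zeroʳ ⌊ old y₁ ≟ old i ⌋) (∧-zeroʳ ⌊ old y₁ ≟ old j ⌋)) (via r q refl refl here)

  exit₂ : ∀ i j → Reach (removeEdge E (old i) (old j)) (old y₂) q
  exit₂ i j = via (old y₂) s (≟-refl y₂)
    (cong₂ _∨_ (∧-zeroʳ ⌊ old y₂ ≟ old i ⌋) (∧-zeroʳ ⌊ old y₂ ≟ old j ⌋)) (via s q refl refl here)

  extend-bridgeless : (∀ i j → Edge G i j → ¬ ¬ Reach (removeEdge E (old i) (old j)) (old i) (old j)) →
                      ¬ HasBridge E
  extend-bridgeless old-detour = bridgeless-by-detours extend-sym extend-connected detour
    where
    detour : ∀ u v → Edge E u v → ¬ ¬ Reach (removeEdge E u v) u v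
    detour q       r       _ = contradiction detour-qr
    detour q       s       _ = contradiction detour-qs
    detour r       q       _ = contradiction (detour-reverse extend-sym detour-qr)
    detour s       q       _ = contradiction (detour-reverse extend-sym detour-qs)
    detour r       (old j) e with refl ← ≟-true⇒≡ e = contradiction detour-ry₁
    detour s       (old j) e with refl ← ≟-true⇒≡ e = contradiction detour-sy₂
    detour (old i) r       e with refl ← ≟-true⇒≡ e = contradiction (detour-reverse extend-sym detour-ry₁)
    detour (old i) s       e with refl ← ≟-true⇒≡ e = contradiction (detour-reverse extend-sym detour-sy₂)
    detour (old i) (old j) e = old-detour i j e
    detour q       q       ()
    detour q       (old j) ()
    detour r       r       ()
    detour r       s       ()
    detour s       r       ()
    detour s       s       ()
    detour (old i) q       ()

module Contraction {n} (A : Adj n) (symA : Sym A) (noBridgeA : ¬ HasBridge A) (x₁ y₁ x₂ y₂ : Fin n)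
  {k} (ι : Fin k → Fin n) (comp : IsComponent (removeTwo A x₁ y₁ x₂ y₂) y₁ ι)
  (y₁′ y₂′ : Fin k) (ι-y₁ : ι y₁′ ≡ y₁) (ι-y₂ : ι y₂′ ≡ y₂) where

  R : Adj n
  R = removeTwo A x₁ y₁ x₂ y₂

  G : Adj k
  G = induced A ι

  Inside : Fin n → Set
  Inside w = Σ (Fin k) λ a → ι a ≡ w

  ι-injective : Injective _≡_ _≡_ ι
  ι-injective = proj₁ comp

  symR : Sym R
  symR = removeEdge-sym (removeEdge-sym symA)

  connG : Connected G
  connG a b = Reach-mono R⊆A (component-connected comp symR a b)
    where
    R⊆A : ∀ {i j} → Edge R i j → Edge A i j
    R⊆A e = proj₁ (removeEdge⁻ {H = A} (proj₁ (removeEdge⁻ {H = removeEdge A x₁ y₁} e)))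

  open Extension G (λ i j → symA (ι i) (ι j)) connG y₁′ y₂′

  contract : Fin n → Fin (3 + k)
  contract w with any? (λ a → ι a ≟ w)
  ... | yes (a , _) = old a
  ... | no _        = q

  contract-ι : ∀ a → contract (ι a) ≡ old a
  contract-ι a with any? (λ b → ι b ≟ ι a)
  ... | yes (b , ιb≡ιa) = cong (λ i → old i) (ι-injective ιb≡ιa)
  ... | no ¬inside      = ⊥-elim (¬inside (a , refl))

  exit : ∀ i j a {w} → Edge A (ι a) w → ¬ Inside w → Reach (removeEdge E (old i) (old j)) (old a) q
  exit i j a {w} e outside
    with crossing-edge-removed₂ (component-reach comp a) (outside ∘ component-member comp) e
  ... | inj₁ removed with sameEdge-true x₁ y₁ (ι a) w removed
  ...   | inj₁ (_ , w≡y₁)  = ⊥-elim (outside (y₁′ , trans ι-y₁ (sym w≡y₁)))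
  ...   | inj₂ (ιa≡y₁ , _) with refl ← ι-injective (trans ιa≡y₁ (sym ι-y₁)) = exit₁ i j
  exit i j a {w} e outside
      | inj₂ removed with sameEdge-true x₂ y₂ (ι a) w removed
  ...   | inj₁ (_ , w≡y₂)  = ⊥-elim (outside (y₂′ , trans ι-y₂ (sym w≡y₂)))
  ...   | inj₂ (ιa≡y₂ , _) with refl ← ι-injective (trans ιa≡y₂ (sym ι-y₂)) = exit₂ i j

  contract-edge : ∀ i j {w w′} → Edge (removeEdge A (ι i) (ι j)) w w′ →
                  Reach (removeEdge E (old i) (old j)) (contract w) (contract w′)
  contract-edge i j {w} {w′} e with any? (λ a → ι a ≟ w) | any? (λ a → ι a ≟ w′)
  ... | yes (a , refl) | yes (b , refl) =
        step (trans (sym (removeEdge-induced {H = E} old-injective i j a b))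
                    (trans (removeEdge-induced {H = A} ι-injective i j a b) e)) here
  ... | yes (a , refl) | no outside = exit i j a (proj₁ (removeEdge⁻ {H = A} e)) outside
  ... | no outside | yes (b , refl) =
        Reach-sym (removeEdge-sym extend-sym)
                  (exit i j b (trans (symA (ι b) w) (proj₁ (removeEdge⁻ {H = A} e))) outside)
  ... | no _ | no _ = here

  old-detour : ∀ i j → Edge G i j → ¬ ¬ Reach (removeEdge E (old i) (old j)) (old i) (old j)
  old-detour i j e = ¬¬-map
    (λ connA → subst₂ (Reach _) (contract-ι i) (contract-ι j)
                 (Reach-map contract (contract-edge i j) (connA (ι i) (ι j))))
    (λ disconnected → noBridgeA (ι i , ι j , e , disconnected))

  extension-bridgeless : ¬ HasBridge E
  extension-bridgeless = extend-bridgeless old-detour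

lemma4p2 : ∀ (n : ℕ) (A : Adj n) →
    SimpleGraph A → Connected A → Cubic A → Biconnected A →
    -- the chosen bi-bridge {x₁y₁, x₂y₂}, four distinct endpoints
    ∀ (x₁ y₁ x₂ y₂ : Fin n) →
    IsBiBridge A x₁ y₁ x₂ y₂ →
    x₁ ≢ y₁ → x₁ ≢ x₂ → x₁ ≢ y₂ → y₁ ≢ x₂ → y₁ ≢ y₂ → x₂ ≢ y₂ →
    -- G₁ = induced subgraph on the component of y₁ (containing y₂),
    -- G₂ = induced subgraph on the component of x₁ (containing x₂)
    ∀ (k₁ k₂ : ℕ) (ι₁ : Fin k₁ → Fin n) (ι₂ : Fin k₂ → Fin n) →
    IsComponent (removeTwo A x₁ y₁ x₂ y₂) y₁ ι₁ →
    IsComponent (removeTwo A x₁ y₁ x₂ y₂) x₁ ι₂ →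
    Reach (removeTwo A x₁ y₁ x₂ y₂) y₁ y₂ →
    Reach (removeTwo A x₁ y₁ x₂ y₂) x₁ x₂ →
    -- the split is as balanced as possible among all bi-bridges
    (∀ (a b c d : Fin n) → IsBiBridge A a b c d →
       ∀ (k : ℕ) (ι : Fin k → Fin n) → IsComponent (removeTwo A a b c d) a ι →
       ∣ k₁ - k₂ ∣ ≤ ∣ k - (n ∸ k) ∣) →
    -- G₁ has at least as many pairwise distinct edges lying in cycles as G₂
    ∀ (m₁ m₂ : ℕ) →
    NumDistinctCycleEdges (induced A ι₁) m₁ →
    NumDistinctCycleEdges (induced A ι₂) m₂ →
    m₂ ≤ m₁ →
    -- y₁, y₂ as vertices of G₁
    ∀ (y₁′ y₂′ : Fin k₁) → ι₁ y₁′ ≡ y₁ → ι₁ y₂′ ≡ y₂ →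
    -- G₁' has no bridge
    ¬ HasBridge (extend (induced A ι₁) y₁′ y₂′)
lemma4p2 n A (symA , _) _ _ (_ , noBridgeA , _) x₁ y₁ x₂ y₂ _ _ _ _ _ _ _
         k₁ _ ι₁ _ comp₁ _ _ _ _ _ _ _ _ _ y₁′ y₂′ ι₁-y₁ ι₁-y₂ =
  Contraction.extension-bridgeless A symA noBridgeA x₁ y₁ x₂ y₂ ι₁ comp₁ y₁′ y₂′ ι₁-y₁ ι₁-y₂
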